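{- Let $M$ be a matroid of rank $r$ having two nontrivial connected flats $X$ and $X'$ such that (1) $X\cap X'\neq\emptyset$, (2) $r(X\cup X')=r$, and (3) $X\cup X'$ is a proper subset of $E(M)$. Then $M$ is not a lattice path matroid.
   Context: Lattice paths start at $(0,0)$ and use steps $E=(1,0)$ and $N=(0,1)$. For lattice paths $P,Q$ from $(0,0)$ to $(m,r)$ with $P$ never going above $Q$, let $\mathcal{P}$ be the set of lattice paths from $(0,0)$ to $(m,r)$ going neither above $Q$ nor below $P$, and for $1\le i\le r$ let $N_i=\{j:\text{step } j \text{ is the } i\text{ -th North step of some path in }\mathcal{P}\}$. $M[P,Q]$ is the transversal matroid on $[m+r]$ with presentation $(N_1,\ldots,N_r)$; a lattice path matroid is a matroid isomorphic to some $M[P,Q]$. A flat $X$ is connected if $M|X$ is connected, and nontrivial if $X$ is dependent. -}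

module Defs where

open import Data.Nat using (ℕ; zero; suc; _+_; _≤_; _<_)
open import Data.Bool using (Bool; true; false; if_then_else_)
open import Data.Fin using (Fin; toℕ)
open import Data.Fin.Subset using (Subset; _∈_; _∉_; _⊆_; _⊂_; _∪_; _∩_; ⁅_⁆; ⊤; ∣_∣; Nonempty)
open import Data.Vec using (Vec; []; _∷_; lookup; tabulate)
open import Data.Product using (Σ; ∃; _×_; _,_)
open import Relation.Nullary using (¬_)
open import Relation.Binary.PropositionalEquality using (_≡_)
open import Function.Bundles using (_↔_; _⇔_; Inverse)

record Matroid (n : ℕ) : Set₁ where
  field
    Indep       : Subset n → Set
    indep-empty : Indep Data.Fin.Subset.⊥
    indep-down  : ∀ {A B} → A ⊆ B → Indep B → Indep A
    indep-aug   : ∀ {A B} → Indep A → Indep B → ∣ A ∣ < ∣ B ∣ →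
                  ∃ λ x → x ∈ B × x ∉ A × Indep (A ∪ ⁅ x ⁆)

open Matroid public

module _ {n : ℕ} (M : Matroid n) where

  HasRank : Subset n → ℕ → Set
  HasRank X k =
    (∃ λ I → I ⊆ X × Indep M I × ∣ I ∣ ≡ k) ×
    (∀ I → I ⊆ X → Indep M I → ∣ I ∣ ≤ k)

  RankOf : ℕ → Set
  RankOf r = HasRank ⊤ r

  Dependent : Subset n → Set
  Dependent X = ¬ Indep M X

  Circuit : Subset n → Set
  Circuit C = Dependent C × (∀ D → D ⊂ C → Indep M D)

  Flat : Subset n → Set
  Flat X = ∀ e → e ∉ X → ∀ k → HasRank X k → ¬ HasRank (X ∪ ⁅ e ⁆) k

  -- M|X is connected: every two distinct elements of X lie in a common
  -- circuit of M|X (the circuits of M|X are the circuits of M inside X)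
  ConnectedRestriction : Subset n → Set
  ConnectedRestriction X =
    ∀ x y → x ∈ X → y ∈ X → ¬ x ≡ y →
    ∃ λ C → Circuit C × C ⊆ X × x ∈ C × y ∈ C

  NontrivialConnectedFlat : Subset n → Set
  NontrivialConnectedFlat X = Flat X × ConnectedRestriction X × Dependent X

-- Lattice paths: a word of k steps, true = North step N, false = East E

prefixN : {k : ℕ} → Vec Bool k → ℕ → ℕ
prefixN []      t       = 0
prefixN (b ∷ v) zero    = 0
prefixN (b ∷ v) (suc t) = (if b then 1 else 0) + prefixN v t

-- a lattice path from (0,0) to (m,r): m + r steps, exactly r of them North
IsPath : (m r : ℕ) → Vec Bool (m + r) → Set
IsPath m r P = prefixN P (m + r) ≡ r

NotAbove : {k : ℕ} → Vec Bool k → Vec Bool k → Set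
NotAbove {k} P Q = ∀ t → t ≤ k → prefixN P t ≤ prefixN Q t

InRegion : (m r : ℕ) → (P Q R : Vec Bool (m + r)) → Set
InRegion m r P Q R = IsPath m r R × NotAbove P R × NotAbove R Q

-- j ∈ N_i  (0-indexed: i : Fin r is the (i+1)-th North step,
-- j : Fin (m + r) is step number j+1)
InN : (m r : ℕ) → (P Q : Vec Bool (m + r)) → Fin r → Fin (m + r) → Set
InN m r P Q i j =
  ∃ λ R → InRegion m r P Q R × lookup R j ≡ true × prefixN R (toℕ j) ≡ toℕ i

-- independent sets of the transversal matroid M[P,Q] with presentation
-- (N_1, …, N_r): partial transversals
LPIndep : (m r : ℕ) → (P Q : Vec Bool (m + r)) → Subset (m + r) → Set
LPIndep m r P Q B =
  ∃ λ (f : Fin (m + r) → Fin r) →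
    (∀ j j' → j ∈ B → j' ∈ B → f j ≡ f j' → j ≡ j') ×
    (∀ j → j ∈ B → InN m r P Q (f j) j)

IsoToLP : {n : ℕ} → Matroid n → (m r : ℕ) → (P Q : Vec Bool (m + r)) → Set
IsoToLP {n} M m r P Q =
  Σ (Fin n ↔ Fin (m + r)) λ φ →
    ∀ (B : Subset (m + r)) →
      Indep M (tabulate (λ e → lookup B (Inverse.to φ e))) ⇔ LPIndep m r P Q B

IsLatticePathMatroid : {n : ℕ} → Matroid n → Set
IsLatticePathMatroid M =
  ∃ λ m → ∃ λ r → ∃ λ (P : Vec Bool (m + r)) → ∃ λ (Q : Vec Bool (m + r)) →
    IsPath m r P × IsPath m r Q × NotAbove P Q × IsoToLP M m r P Q

module Submission where

-- Place the ground set of M ≅ M[P,Q] on the steps 0, 1, … of the paths. Each N_i is a run of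
-- consecutive steps, so by Hall's theorem a set is independent iff every window [a, b) of steps
-- contains at most yQ b − yP a of its elements, where yP and yQ are the heights of P and Q.
-- A circuit C overfills some window that contains all of C; if e ∉ C lies in a wider window that
-- is no less tight, then (C − c) ∪ {e} overfills it too, and a flat containing C contains e.
-- Take e ∉ X ∪ X'. If e lies between two elements of X ∪ X', then, passing through a common
-- element of X and X', it lies between two elements of X or of X', and the circuit through these
-- puts e in that flat. Otherwise e lies, say, after all of X ∪ X'; as X ∪ X' spans, a basis of it
-- shows that Q has made all its North steps by the last element y of X ∪ X', so a window around a
-- circuit through y stretches to e without loosening. Before X ∪ X', P has no North step yet.

open import Defs
open import Data.Nat using (ℕ; zero; suc; _+_; _∸_; _≤_; _<_; _≤?_; _<?_; _≤ᵇ_; _<ᵇ_; _⊔_; _⊓_)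
open import Data.Nat using (z≤n; s≤s; s≤s⁻¹; NonZero)
open import Data.Nat.Properties
open import Data.Nat.DivMod using (_mod_; m<n⇒m%n≡m)
open import Data.Bool using (Bool; true; false; T; _∧_; if_then_else_)
open import Data.Bool.Properties using (T-≡)
open import Data.Unit using (tt)
open import Data.Fin using (Fin; zero; suc; toℕ)
open import Data.Fin.Properties using (any?; toℕ<n; toℕ-injective; toℕ-fromℕ<; nonZeroIndex)
  renaming (_≟_ to _≟ᶠ_)
open import Data.Fin.Subset
  using (Subset; inside; outside; _∈_; _∉_; _⊆_; _⊂_; _∪_; _∩_; _-_; ⁅_⁆; ⊤; ∣_∣; Nonempty)
  renaming (⊥ to ∅)
open import Data.Fin.Subset.Properties
open import Data.Vec using (Vec; []; _∷_; here; there; lookup; tabulate)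
open import Data.Vec.Properties
  using (lookup∘tabulate; lookup-zipWith; []=⇒lookup; lookup⇒[]=; tabulate-cong; tabulate∘lookup)
open import Data.List using (List; []; _∷_; filter; allFin)
open import Data.List.Membership.Propositional using () renaming (_∈_ to _∈ˡ_)
open import Data.List.Membership.Propositional.Properties using (∈-filter⁺; ∈-allFin)
open import Data.List.Relation.Unary.Any using (here; there)
import Data.List.Relation.Unary.All as All
open import Data.List.Relation.Unary.All.Properties using (all-filter)
import Data.List.Extrema ≤-totalOrder as Extrema
open import Data.Product using (∃; ∃₂; _×_; _,_; proj₁; proj₂)
open import Data.Sum using (_⊎_; inj₁; inj₂)
open import Data.Empty using (⊥-elim)
open import Function using (_∘_; _$_; _↔_; _⇔_; Inverse; Equivalence; mk⇔)
open import Relation.Nullary using (¬_; ¬?; Dec; yes; no; does)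
open import Relation.Nullary.Decidable using (_×-dec_; dec-true; dec-false)
open import Relation.Binary.PropositionalEquality
open import Relation.Binary.Definitions using (tri<; tri≈; tri>)
open import Algebra.Properties.CommutativeMonoid.Sum +-0-commutativeMonoid
  using (sum; sum-cong-≗; sum-permute)

𝟙 : Bool → ℕ
𝟙 b = if b then 1 else 0

-- Finite subsets and extrema

x∉p-x : ∀ {n} (p : Subset n) x → x ∉ p - x
x∉p-x (s ∷ p) zero    ()
x∉p-x (s ∷ p) (suc x) (there x∈p-x) = x∉p-x p x x∈p-x

x∈p-y⇒x≢y : ∀ {n} {p : Subset n} {x y} → x ∈ p - y → x ≢ y
x∈p-y⇒x≢y {p = p} {x} x∈p-x refl = x∉p-x p x x∈p-x

∣p∣≤1+∣p-x∣ : ∀ {n} (p : Subset n) x → ∣ p ∣ ≤ suc ∣ p - x ∣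
∣p∣≤1+∣p-x∣ (s ∷ p) zero = ≤-trans (∣s∷p∣≤1+∣p∣ s) (s≤s (p⊆q⇒∣p∣≤∣q∣ (drop-there ∘ suc∈-0 ∘ there)))
  where
  ∣s∷p∣≤1+∣p∣ : ∀ b → ∣ b ∷ p ∣ ≤ suc ∣ p ∣
  ∣s∷p∣≤1+∣p∣ inside  = ≤-refl
  ∣s∷p∣≤1+∣p∣ outside = n≤1+n ∣ p ∣
  suc∈-0 : ∀ {y} → suc y ∈ s ∷ p → suc y ∈ (s ∷ p) - zero
  suc∈-0 y∈ = x∈p∧x≢y⇒x∈p-y {y = zero} y∈ λ ()
∣p∣≤1+∣p-x∣ (inside  ∷ p) (suc x) = s≤s (∣p∣≤1+∣p-x∣ p x)
∣p∣≤1+∣p-x∣ (outside ∷ p) (suc x) = ∣p∣≤1+∣p-x∣ p x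

p⊆q⇒∣p∣≤∣p∩q∣ : ∀ {n} {p q : Subset n} → p ⊆ q → ∣ p ∣ ≤ ∣ p ∩ q ∣
p⊆q⇒∣p∣≤∣p∩q∣ p⊆q = p⊆q⇒∣p∣≤∣q∣ (λ x∈p → x∈p∩q⁺ (x∈p , p⊆q x∈p))

∣p∣≤∣p-x∪⁅y⁆∣ : ∀ {n} (p : Subset n) {x y} → y ∉ p → ∣ p ∣ ≤ ∣ (p - x) ∪ ⁅ y ⁆ ∣
∣p∣≤∣p-x∪⁅y⁆∣ p {x} {y} y∉p = ≤-trans (∣p∣≤1+∣p-x∣ p x) (p⊂q⇒∣p∣<∣q∣ (x∈p∪q⁺ ∘ inj₁ , y , y∈ , y∉p ∘ p─q⊆p p _))
  where y∈ = x∈p∪q⁺ (inj₂ (x∈⁅x⁆ y))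

module _ {n k} (f : Fin n → Fin k) where

  preimage : Subset k → Subset n
  preimage S = tabulate (lookup S ∘ f)

  ∈-preimage⁻ : ∀ {S x} → x ∈ preimage S → f x ∈ S
  ∈-preimage⁻ {S} {x} x∈ = lookup⇒[]= (f x) S (trans (sym (lookup∘tabulate _ x)) ([]=⇒lookup x∈))

InjectiveOn : ∀ {n} {A : Set} → Subset n → (Fin n → A) → Set
InjectiveOn D g = ∀ {x y} → x ∈ D → y ∈ D → g x ≡ g y → x ≡ y

increasing⇒injectiveOn : ∀ {n} (D : Subset n) (g : Fin n → ℕ) →
  (∀ {x y} → x ∈ D → y ∈ D → toℕ x < toℕ y → g x < g y) → InjectiveOn D g
increasing⇒injectiveOn D g incr {x} {y} x∈D y∈D gx≡gy with <-cmp (toℕ x) (toℕ y)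
... | tri< x<y _ _ = ⊥-elim (<-irrefl gx≡gy (incr x∈D y∈D x<y))
... | tri≈ _ x≡y _ = toℕ-injective x≡y
... | tri> _ _ y<x = ⊥-elim (<-irrefl (sym gx≡gy) (incr y∈D x∈D y<x))

interval-pigeonhole : ∀ {n} (D : Subset n) (g : Fin n → ℕ) {lo} hi → InjectiveOn D g →
  (∀ {x} → x ∈ D → lo ≤ g x × g x < hi) → ∣ D ∣ ≤ hi ∸ lo
interval-pigeonhole {n} D g zero inj range =
  ≤-trans (p⊆q⇒∣p∣≤∣q∣ {q = ∅} (λ x∈D → ⊥-elim (n≮0 (proj₂ (range x∈D)))))
          (≤-trans (≤-reflexive (∣⊥∣≡0 n)) z≤n)
interval-pigeonhole D g {lo} (suc h) inj range with any? (λ x → (x ∈? D) ×-dec (g x ≟ h))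
... | no ¬top = ≤-trans (interval-pigeonhole D g h inj below-h) (∸-monoˡ-≤ lo (n≤1+n h))
  where
  below-h : ∀ {x} → x ∈ D → lo ≤ g x × g x < h
  below-h x∈D = proj₁ (range x∈D) , ≤∧≢⇒< (s≤s⁻¹ (proj₂ (range x∈D))) (λ gx≡h → ¬top (_ , x∈D , gx≡h))
... | yes (t , t∈D , gt≡h) = begin
    ∣ D ∣              ≤⟨ ∣p∣≤1+∣p-x∣ D t ⟩
    suc ∣ D - t ∣      ≤⟨ s≤s (interval-pigeonhole (D - t) g h inj-t below-h) ⟩
    suc (h ∸ lo)       ≡⟨ +-∸-assoc 1 lo≤h ⟨
    suc h ∸ lo         ∎
  where
  open ≤-Reasoning
  lo≤h : lo ≤ h
  lo≤h = subst (lo ≤_) gt≡h (proj₁ (range t∈D))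
  inj-t : InjectiveOn (D - t) g
  inj-t x∈ y∈ = inj (p─q⊆p D _ x∈) (p─q⊆p D _ y∈)
  below-h : ∀ {x} → x ∈ D - t → lo ≤ g x × g x < h
  below-h {x} x∈D-t = proj₁ (range x∈D) , ≤∧≢⇒< (s≤s⁻¹ (proj₂ (range x∈D))) gx≢h
    where
    x∈D = p─q⊆p D _ x∈D-t
    gx≢h : g x ≢ h
    gx≢h gx≡h = x∈p-y⇒x≢y x∈D-t (inj x∈D t∈D (trans gx≡h (sym gt≡h)))

∣p∣≡sum : ∀ {n} (p : Subset n) → ∣ p ∣ ≡ sum (𝟙 ∘ lookup p)
∣p∣≡sum []            = refl
∣p∣≡sum (inside  ∷ p) = cong suc (∣p∣≡sum p)
∣p∣≡sum (outside ∷ p) = ∣p∣≡sum p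

∣∣-reindex : ∀ {n k} (π : Fin n ↔ Fin k) (p : Subset n) (q : Subset k) →
  (∀ x → lookup p x ≡ lookup q (Inverse.to π x)) → ∣ p ∣ ≡ ∣ q ∣
∣∣-reindex π p q p≗q∘π = begin
  ∣ p ∣                                ≡⟨ ∣p∣≡sum p ⟩
  sum (𝟙 ∘ lookup p)                   ≡⟨ sum-cong-≗ (cong 𝟙 ∘ p≗q∘π) ⟩
  sum (𝟙 ∘ lookup q ∘ Inverse.to π)    ≡⟨ sum-permute (𝟙 ∘ lookup q) π ⟨
  sum (𝟙 ∘ lookup q)                   ≡⟨ ∣p∣≡sum q ⟨
  ∣ q ∣                                ∎
  where open ≡-Reasoning

module _ {n} (w : Fin n → ℕ) (Y : Subset n) where

  private
    members : List (Fin n)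
    members = filter (_∈? Y) (allFin n)

    ∈-members : ∀ {x} → x ∈ Y → x ∈ˡ members
    ∈-members x∈Y = ∈-filter⁺ (_∈? Y) (∈-allFin _) x∈Y

  heaviest : Nonempty Y → ∃ λ y → y ∈ Y × (∀ {x} → x ∈ Y → w x ≤ w y)
  heaviest (y₀ , y₀∈Y) =
    Extrema.argmax w y₀ members ,
    Extrema.argmax-all w y₀∈Y (all-filter (_∈? Y) (allFin n)) ,
    λ x∈Y → All.lookup (Extrema.f[xs]≤f[argmax] y₀ members) (∈-members x∈Y)

  lightest : Nonempty Y → ∃ λ y → y ∈ Y × (∀ {x} → x ∈ Y → w y ≤ w x)
  lightest (y₀ , y₀∈Y) =
    Extrema.argmin w y₀ members ,
    Extrema.argmin-all w y₀∈Y (all-filter (_∈? Y) (allFin n)) ,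
    λ x∈Y → All.lookup (Extrema.f[argmin]≤f[xs] y₀ members) (∈-members x∈Y)

maxUpTo : (ℕ → ℕ) → ℕ → ℕ
maxUpTo g zero    = g zero
maxUpTo g (suc t) = maxUpTo g t ⊔ g (suc t)

≤-maxUpTo : ∀ g {a t} → a ≤ t → g a ≤ maxUpTo g t
≤-maxUpTo g {t = zero}  z≤n = ≤-refl
≤-maxUpTo g {a} {suc t} a≤1+t with m≤n⇒m<n∨m≡n a≤1+t
... | inj₁ a<1+t = ≤-trans (≤-maxUpTo g (s≤s⁻¹ a<1+t)) (m≤m⊔n _ _)
... | inj₂ refl  = m≤n⊔m (maxUpTo g t) (g a)

maxUpTo-attained : ∀ g t → ∃ λ a → a ≤ t × maxUpTo g t ≡ g a
maxUpTo-attained g zero = zero , z≤n , refl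
maxUpTo-attained g (suc t) with ⊔-sel (maxUpTo g t) (g (suc t))
... | inj₂ ≡g[1+t] = suc t , ≤-refl , ≡g[1+t]
... | inj₁ ≡max    with maxUpTo-attained g t
...   | a , a≤t , ≡ga = a , m≤n⇒m≤1+n a≤t , trans ≡max ≡ga

-- Windows [a, b) of positions

dec-true⁻ : ∀ {A : Set} (A? : Dec A) → does A? ≡ true → A
dec-true⁻ (yes a) _ = a

-- Opaque, so that unification recovers pos, a and b from window pos a b.
opaque
  window : ∀ {n} → (Fin n → ℕ) → ℕ → ℕ → Subset n
  window pos a b = tabulate (λ x → does ((a ≤? pos x) ×-dec (pos x <? b)))

module _ {n} {pos : Fin n → ℕ} {a b : ℕ} {x : Fin n} where
  opaque
    unfolding window

    ∈-window⁺ : a ≤ pos x → pos x < b → x ∈ window pos a b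
    ∈-window⁺ a≤x x<b =
      lookup⇒[]= x _ (trans (lookup∘tabulate _ x) (dec-true ((a ≤? pos x) ×-dec (pos x <? b)) (a≤x , x<b)))

    ∈-window⁻ : x ∈ window pos a b → a ≤ pos x × pos x < b
    ∈-window⁻ x∈w =
      dec-true⁻ ((a ≤? pos x) ×-dec (pos x <? b)) (trans (sym (lookup∘tabulate _ x)) ([]=⇒lookup x∈w))

opaque
  unfolding window

  window-preimage : ∀ {n k} (f : Fin n → Fin k) (w : Fin k → ℕ) a b →
    window (w ∘ f) a b ≡ preimage f (window w a b)
  window-preimage f w a b = tabulate-cong (λ x → sym (lookup∘tabulate _ (f x)))

window-mono : ∀ {n} {pos : Fin n → ℕ} {a b a' b'} → a' ≤ a → b ≤ b' → window pos a b ⊆ window pos a' b'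
window-mono a'≤a b≤b' x∈w with ∈-window⁻ x∈w
... | a≤x , x<b = ∈-window⁺ (≤-trans a'≤a a≤x) (≤-trans x<b b≤b')

∩-window-⊂ : ∀ {n} {pos : Fin n → ℕ} {S : Subset n} {a b x} → x ∈ S → a ≤ pos x → pos x < b →
  S ∩ window pos a (pos x) ⊂ S ∩ window pos a b
∩-window-⊂ {pos = pos} {S} {a} {b} {x} x∈S a≤x x<b = narrower⊆wider , x , x∈wider , x∉narrower
  where
  narrower⊆wider : S ∩ window pos a (pos x) ⊆ S ∩ window pos a b
  narrower⊆wider y∈ with x∈p∩q⁻ S (window pos a (pos x)) y∈
  ... | y∈S , y∈w = x∈p∩q⁺ (y∈S , window-mono ≤-refl (<⇒≤ x<b) y∈w)
  x∈wider : x ∈ S ∩ window pos a b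
  x∈wider = x∈p∩q⁺ (x∈S , ∈-window⁺ a≤x x<b)
  x∉narrower : x ∉ S ∩ window pos a (pos x)
  x∉narrower x∈ = <-irrefl refl (proj₂ (∈-window⁻ (proj₂ (x∈p∩q⁻ S (window pos a (pos x)) x∈))))

-- Lattice paths and the presentation (N₁, …, N_r)

UnitSteps : (ℕ → ℕ) → Set
UnitSteps h = ∀ t → h t ≤ h (suc t) × h (suc t) ≤ suc (h t)

UnitSteps-⊔ : ∀ {f g} → UnitSteps f → UnitSteps g → UnitSteps (λ t → f t ⊔ g t)
UnitSteps-⊔ f-steps g-steps t =
  ⊔-mono-≤ (proj₁ (f-steps t)) (proj₁ (g-steps t)) , ⊔-mono-≤ (proj₂ (f-steps t)) (proj₂ (g-steps t))

UnitSteps-⊓ : ∀ {f g} → UnitSteps f → UnitSteps g → UnitSteps (λ t → f t ⊓ g t)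
UnitSteps-⊓ f-steps g-steps t =
  ⊓-mono-≤ (proj₁ (f-steps t)) (proj₁ (g-steps t)) , ⊓-mono-≤ (proj₂ (f-steps t)) (proj₂ (g-steps t))

UnitSteps-threshold : ∀ j i → UnitSteps (λ t → if t ≤ᵇ j then i else suc i)
UnitSteps-threshold j i t with t ≤ᵇ j in t≤ᵇj | t <ᵇ j in t<ᵇj
... | true  | true  = ≤-refl , n≤1+n i
... | true  | false = n≤1+n i , ≤-refl
... | false | false = ≤-refl , n≤1+n (suc i)
... | false | true  = ⊥-elim (subst T t≤ᵇj (≤⇒≤ᵇ (<⇒≤ (<ᵇ⇒< t j (subst T (sym t<ᵇj) tt)))))

UnitSteps-mono : ∀ {h} → UnitSteps h → ∀ {t t'} → t ≤ t' → h t ≤ h t'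
UnitSteps-mono steps {t} {t'} t≤t' with m≤n⇒m<n∨m≡n t≤t'
... | inj₂ refl = ≤-refl
UnitSteps-mono steps {t} {suc t'} t≤t' | inj₁ t<1+t' =
  ≤-trans (UnitSteps-mono steps (s≤s⁻¹ t<1+t')) (proj₁ (steps t'))

unit-step : ∀ {x y} → x ≤ y → y ≤ suc x → y ≡ x + 𝟙 (x <ᵇ y)
unit-step {x} {y} x≤y y≤1+x with x <ᵇ y in x<ᵇy
... | true  = trans (≤-antisym y≤1+x (<ᵇ⇒< x y (subst T (sym x<ᵇy) tt))) (+-comm 1 x)
... | false = trans (≤-antisym (≮⇒≥ λ x<y → subst T x<ᵇy (<⇒<ᵇ x<y)) x≤y) (sym (+-identityʳ x))

prefixN-zero : ∀ {k} (v : Vec Bool k) → prefixN v 0 ≡ 0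
prefixN-zero []      = refl
prefixN-zero (b ∷ v) = refl

UnitSteps-prefixN : ∀ {k} (v : Vec Bool k) → UnitSteps (prefixN v)
UnitSteps-prefixN []      t       = z≤n , z≤n
UnitSteps-prefixN (b ∷ v) zero    rewrite prefixN-zero v | +-identityʳ (𝟙 b) with b
... | true  = z≤n , ≤-refl
... | false = z≤n , z≤n
UnitSteps-prefixN (b ∷ v) (suc t) =
  +-monoʳ-≤ (𝟙 b) (proj₁ (UnitSteps-prefixN v t)) ,
  ≤-trans (+-monoʳ-≤ (𝟙 b) (proj₂ (UnitSteps-prefixN v t))) (≤-reflexive (+-suc (𝟙 b) _))

prefixN-suc : ∀ {k} (v : Vec Bool k) (x : Fin k) →
  prefixN v (suc (toℕ x)) ≡ prefixN v (toℕ x) + 𝟙 (lookup v x)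
prefixN-suc (b ∷ v) zero    rewrite prefixN-zero v = +-comm (𝟙 b) 0
prefixN-suc (b ∷ v) (suc x) rewrite prefixN-suc v x = sym (+-assoc (𝟙 b) _ _)

prefixN-rises : ∀ {k} (v : Vec Bool k) {x : Fin k} → x ∈ v → prefixN v (toℕ x) < prefixN v (suc (toℕ x))
prefixN-rises v {x} x∈v rewrite prefixN-suc v x | []=⇒lookup x∈v = ≤-reflexive (+-comm 1 _)

∣v∣≡prefixN : ∀ {k} (v : Vec Bool k) → ∣ v ∣ ≡ prefixN v k
∣v∣≡prefixN []            = refl
∣v∣≡prefixN (inside  ∷ v) = cong suc (∣v∣≡prefixN v)
∣v∣≡prefixN (outside ∷ v) = ∣v∣≡prefixN v

stepsOf : ∀ k → (ℕ → ℕ) → Vec Bool k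
stepsOf k h = tabulate (λ x → h (toℕ x) <ᵇ h (suc (toℕ x)))

prefixN-stepsOf : ∀ k {h} → UnitSteps h → ∀ {t} → t ≤ k → h 0 + prefixN (stepsOf k h) t ≡ h t
prefixN-stepsOf zero    steps z≤n = +-identityʳ _
prefixN-stepsOf (suc k) steps z≤n = +-identityʳ _
prefixN-stepsOf (suc k) {h} steps {suc t} (s≤s t≤k) = begin
  h 0 + (𝟙 (h 0 <ᵇ h 1) + y t) ≡⟨ +-assoc (h 0) _ _ ⟨
  h 0 + 𝟙 (h 0 <ᵇ h 1) + y t   ≡⟨ cong (_+ y t) (unit-step (proj₁ (steps 0)) (proj₂ (steps 0))) ⟨
  h 1 + y t                    ≡⟨ prefixN-stepsOf k (steps ∘ suc) t≤k ⟩
  h (suc t)                    ∎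
  where
  open ≡-Reasoning
  y : ℕ → ℕ
  y = prefixN (stepsOf k (h ∘ suc))

module LatticePath (m ρ : ℕ) (P Q : Vec Bool (m + ρ))
  (P-path : IsPath m ρ P) (Q-path : IsPath m ρ Q) (P≤Q : NotAbove P Q) where

  k : ℕ
  k = m + ρ

  yP yQ : ℕ → ℕ
  yP = prefixN P
  yQ = prefixN Q

  yP-mono : ∀ {t t'} → t ≤ t' → yP t ≤ yP t'
  yP-mono = UnitSteps-mono (UnitSteps-prefixN P)

  yQ-mono : ∀ {t t'} → t ≤ t' → yQ t ≤ yQ t'
  yQ-mono = UnitSteps-mono (UnitSteps-prefixN Q)

  yQ≤ρ : ∀ {t} → t ≤ k → yQ t ≤ ρ
  yQ≤ρ t≤k = ≤-trans (yQ-mono t≤k) (≤-reflexive Q-path)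

  yP≤yQ : ∀ {a b} → a ≤ b → b ≤ k → yP a ≤ yQ b
  yP≤yQ a≤b b≤k = ≤-trans (P≤Q _ (≤-trans a≤b b≤k)) (yQ-mono a≤b)

  InN⇒bounds : ∀ {i j} → InN m ρ P Q i j → yP (toℕ j) ≤ toℕ i × toℕ i < yQ (suc (toℕ j))
  InN⇒bounds {i} {j} (R , (_ , P≤R , R≤Q) , j∈R , yR[j]≡i) =
    ≤-trans (P≤R (toℕ j) (<⇒≤ (toℕ<n j))) (≤-reflexive yR[j]≡i) ,
    ≤-trans (≤-reflexive 1+i≡yR[1+j]) (R≤Q (suc (toℕ j)) (toℕ<n j))
    where
    1+i≡yR[1+j] : suc (toℕ i) ≡ prefixN R (suc (toℕ j))
    1+i≡yR[1+j] rewrite prefixN-suc R j | yR[j]≡i | j∈R = +-comm 1 (toℕ i)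

  -- The witness path runs at height i up to step j and at height i + 1 after it, clamped between P and Q.
  bounds⇒InN : ∀ {i j} → yP (toℕ j) ≤ toℕ i → toℕ i < yQ (suc (toℕ j)) → InN m ρ P Q i j
  bounds⇒InN {i} {j} yP[j]≤i i<yQ[1+j] = R , (R-path , P≤R , R≤Q) , j∈R , yR[j]≡i
    where
    h : ℕ → ℕ
    h t = yP t ⊔ (yQ t ⊓ (if t ≤ᵇ toℕ j then toℕ i else suc (toℕ i)))

    h-steps : UnitSteps h
    h-steps = UnitSteps-⊔ (UnitSteps-prefixN P)
                (UnitSteps-⊓ (UnitSteps-prefixN Q) (UnitSteps-threshold (toℕ j) (toℕ i)))

    R : Vec Bool k
    R = stepsOf k h

    yR≡h : ∀ {t} → t ≤ k → prefixN R t ≡ h t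
    yR≡h t≤k rewrite sym (prefixN-stepsOf k h-steps t≤k) | prefixN-zero P | prefixN-zero Q = refl

    h[j]≡i : h (toℕ j) ≡ toℕ i
    h[j]≡i rewrite dec-true (toℕ j ≤? toℕ j) ≤-refl
             | m≥n⇒m⊓n≡n (s≤s⁻¹ (≤-trans i<yQ[1+j] (proj₂ (UnitSteps-prefixN Q (toℕ j))))) =
      m≤n⇒m⊔n≡n yP[j]≤i

    h[1+j]≡1+i : h (suc (toℕ j)) ≡ suc (toℕ i)
    h[1+j]≡1+i rewrite dec-false (suc (toℕ j) ≤? toℕ j) (n≮n (toℕ j)) | m≥n⇒m⊓n≡n i<yQ[1+j] =
      m≤n⇒m⊔n≡n (≤-trans (proj₂ (UnitSteps-prefixN P (toℕ j))) (s≤s yP[j]≤i))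

    R-path : IsPath m ρ R
    R-path rewrite yR≡h (≤-refl {k}) | P-path =
      m≥n⇒m⊔n≡m (≤-trans (m⊓n≤m (yQ k) _) (≤-reflexive Q-path))

    P≤R : NotAbove P R
    P≤R t t≤k rewrite yR≡h t≤k = m≤m⊔n (yP t) _

    R≤Q : NotAbove R Q
    R≤Q t t≤k rewrite yR≡h t≤k = ⊔-lub (P≤Q t t≤k) (m⊓n≤m (yQ t) _)

    j∈R : lookup R j ≡ true
    j∈R rewrite lookup∘tabulate (λ x → h (toℕ x) <ᵇ h (suc (toℕ x))) j | h[j]≡i | h[1+j]≡1+i =
      Equivalence.to T-≡ (<⇒<ᵇ (n<1+n (toℕ i)))

    yR[j]≡i : prefixN R (toℕ j) ≡ toℕ i
    yR[j]≡i = trans (yR≡h (<⇒≤ (toℕ<n j))) h[j]≡i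

  Hall : ∀ {n} → (Fin n → ℕ) → Subset n → Set
  Hall pos A = ∀ a b → a < b → b ≤ k → ∣ A ∩ window pos a b ∣ + yP a ≤ yQ b

  LPIndep⇒Hall : ∀ S → LPIndep m ρ P Q S → Hall toℕ S
  LPIndep⇒Hall S (f , f-inj , f-InN) a b a<b b≤k =
    m≤o∸n⇒m+n≤o ∣ D ∣ (yP≤yQ (<⇒≤ a<b) b≤k) (interval-pigeonhole D (toℕ ∘ f) (yQ b) index-inj index-range)
    where
    D = S ∩ window toℕ a b

    index-inj : InjectiveOn D (toℕ ∘ f)
    index-inj j∈D j'∈D ≡ = f-inj _ _ (proj₁ (x∈p∩q⁻ S _ j∈D)) (proj₁ (x∈p∩q⁻ S _ j'∈D)) (toℕ-injective ≡)

    index-range : ∀ {j} → j ∈ D → yP a ≤ toℕ (f j) × toℕ (f j) < yQ b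
    index-range {j} j∈D =
      ≤-trans (yP-mono a≤j) yP[j]≤i , ≤-trans i<yQ[1+j] (yQ-mono j<b)
      where
      j∈S,w = x∈p∩q⁻ S (window toℕ a b) j∈D
      a≤j = proj₁ (∈-window⁻ (proj₂ j∈S,w))
      j<b = proj₂ (∈-window⁻ (proj₂ j∈S,w))
      yP[j]≤i = proj₁ (InN⇒bounds (f-InN j (proj₁ j∈S,w)))
      i<yQ[1+j] = proj₂ (InN⇒bounds (f-InN j (proj₁ j∈S,w)))

  Hall-Q : Hall toℕ Q
  Hall-Q a b a<b b≤k =
    m≤o∸n⇒m+n≤o ∣ D ∣ (yP≤yQ (<⇒≤ a<b) b≤k)
      (≤-trans (interval-pigeonhole D (yQ ∘ toℕ) (yQ b) height-inj height-range)
               (∸-monoʳ-≤ (yQ b) (P≤Q a (≤-trans (<⇒≤ a<b) b≤k))))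
    where
    D = Q ∩ window toℕ a b

    height-inj : InjectiveOn D (yQ ∘ toℕ)
    height-inj = increasing⇒injectiveOn D (yQ ∘ toℕ) λ j∈D _ j<j' →
      ≤-trans (prefixN-rises Q (proj₁ (x∈p∩q⁻ Q _ j∈D))) (yQ-mono j<j')

    height-range : ∀ {j} → j ∈ D → yQ a ≤ yQ (toℕ j) × yQ (toℕ j) < yQ b
    height-range j∈D with x∈p∩q⁻ Q (window toℕ a b) j∈D
    ... | j∈Q , j∈w = yQ-mono (proj₁ (∈-window⁻ j∈w)) ,
                      ≤-trans (prefixN-rises Q j∈Q) (yQ-mono (proj₂ (∈-window⁻ j∈w)))

  -- Greedy matching: j ∈ S gets the lowest index left over by the earlier elements of S, namely
  -- the maximum over a ≤ j of yP a + #(S ∩ [a, j)); Hall's condition on [a, j + 1) bounds it.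
  module Greedy (S : Subset k) (hall : Hall toℕ S) where

    lowest : ℕ → ℕ → ℕ
    lowest t a = yP a + ∣ S ∩ window toℕ a t ∣

    level : Fin k → ℕ
    level j = maxUpTo (lowest (toℕ j)) (toℕ j)

    yP≤level : ∀ j → yP (toℕ j) ≤ level j
    yP≤level j = ≤-trans (m≤m+n (yP (toℕ j)) _) (≤-maxUpTo (lowest (toℕ j)) ≤-refl)

    count-rises : ∀ {a j b} → j ∈ S → a ≤ toℕ j → toℕ j < b →
      ∣ S ∩ window toℕ a (toℕ j) ∣ < ∣ S ∩ window toℕ a b ∣
    count-rises j∈S a≤j j<b = p⊂q⇒∣p∣<∣q∣ (∩-window-⊂ j∈S a≤j j<b)

    level<yQ : ∀ {j} → j ∈ S → level j < yQ (suc (toℕ j))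
    level<yQ {j} j∈S with maxUpTo-attained (lowest (toℕ j)) (toℕ j)
    ... | a , a≤j , level≡ = begin-strict
      level j                                          ≡⟨ level≡ ⟩
      yP a + ∣ S ∩ window toℕ a (toℕ j) ∣              <⟨ +-monoʳ-< (yP a) (count-rises j∈S a≤j ≤-refl) ⟩
      yP a + ∣ S ∩ window toℕ a (suc (toℕ j)) ∣        ≡⟨ +-comm (yP a) _ ⟩
      ∣ S ∩ window toℕ a (suc (toℕ j)) ∣ + yP a        ≤⟨ hall a (suc (toℕ j)) (s≤s a≤j) (toℕ<n j) ⟩
      yQ (suc (toℕ j))                                 ∎
      where open ≤-Reasoning

    level-increasing : ∀ {j j'} → j ∈ S → j' ∈ S → toℕ j < toℕ j' → level j < level j'
    level-increasing {j} {j'} j∈S _ j<j' with maxUpTo-attained (lowest (toℕ j)) (toℕ j)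
    ... | a , a≤j , level≡ = begin-strict
      level j                                     ≡⟨ level≡ ⟩
      yP a + ∣ S ∩ window toℕ a (toℕ j) ∣         <⟨ +-monoʳ-< (yP a) (count-rises j∈S a≤j j<j') ⟩
      yP a + ∣ S ∩ window toℕ a (toℕ j') ∣        ≤⟨ ≤-maxUpTo (lowest (toℕ j')) (≤-trans a≤j (<⇒≤ j<j')) ⟩
      level j'                                    ∎
      where open ≤-Reasoning

    module _ {{_ : NonZero ρ}} where

      -- Reducing mod ρ only makes match total: on S it does nothing (toℕ-match).
      match : Fin k → Fin ρ
      match j = level j mod ρ

      toℕ-match : ∀ {j} → j ∈ S → toℕ (match j) ≡ level j
      toℕ-match {j} j∈S = trans (toℕ-fromℕ< _) (m<n⇒m%n≡m (≤-trans (level<yQ j∈S) (yQ≤ρ (toℕ<n j))))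

      matching : LPIndep m ρ P Q S
      matching = match , match-inj , match-InN
        where
        match-inj : ∀ j j' → j ∈ S → j' ∈ S → match j ≡ match j' → j ≡ j'
        match-inj j j' j∈S j'∈S ≡ =
          increasing⇒injectiveOn S level level-increasing j∈S j'∈S
            (trans (sym (toℕ-match j∈S)) (trans (cong toℕ ≡) (toℕ-match j'∈S)))

        match-InN : ∀ j → j ∈ S → InN m ρ P Q (match j) j
        match-InN j j∈S = bounds⇒InN (≤-trans (yP≤level j) (≤-reflexive (sym (toℕ-match j∈S))))
                                     (≤-trans (≤-reflexive (cong suc (toℕ-match j∈S))) (level<yQ j∈S))

  Hall⇒LPIndep : {{_ : NonZero ρ}} → ∀ S → Hall toℕ S → LPIndep m ρ P Q S
  Hall⇒LPIndep S hall = Greedy.matching S hall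

-- Matroids

∪⁅⁆-mono : ∀ {n} {p q : Subset n} x → p ⊆ q → p ∪ ⁅ x ⁆ ⊆ q ∪ ⁅ x ⁆
∪⁅⁆-mono {p = p} x p⊆q y∈ with x∈p∪q⁻ p ⁅ x ⁆ y∈
... | inj₁ y∈p = x∈p∪q⁺ (inj₁ (p⊆q y∈p))
... | inj₂ y=x = x∈p∪q⁺ (inj₂ y=x)

module _ {n} (M : Matroid n) where

  Spanned : Subset n → Fin n → Set
  Spanned B x = x ∈ B ⊎ Dependent M (B ∪ ⁅ x ⁆)

  Spanned-mono : ∀ {B B' x} → B ⊆ B' → Spanned B x → Spanned B' x
  Spanned-mono B⊆B' (inj₁ x∈B)   = inj₁ (B⊆B' x∈B)
  Spanned-mono B⊆B' (inj₂ Bx-dep) = inj₂ (Bx-dep ∘ indep-down M (∪⁅⁆-mono _ B⊆B'))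

  MaximalIndepIn : Subset n → Subset n → Set
  MaximalIndepIn F B = B ⊆ F × Indep M B × (∀ {x} → x ∈ F → Spanned B x)

  maximal⇒HasRank : ∀ {F B} → MaximalIndepIn F B → HasRank M F ∣ B ∣
  maximal⇒HasRank {F} {B} (B⊆F , B-indep , B-max) = (B , B⊆F , B-indep , refl) , bound
    where
    bound : ∀ J → J ⊆ F → Indep M J → ∣ J ∣ ≤ ∣ B ∣
    bound J J⊆F J-indep with ∣ J ∣ ≤? ∣ B ∣
    ... | yes ∣J∣≤∣B∣ = ∣J∣≤∣B∣
    ... | no ∣J∣≰∣B∣ with indep-aug M B-indep J-indep (≰⇒> ∣J∣≰∣B∣)
    ...   | x , x∈J , x∉B , Bx-indep with B-max (J⊆F x∈J)
    ...     | inj₁ x∈B    = ⊥-elim (x∉B x∈B)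
    ...     | inj₂ Bx-dep = ⊥-elim (Bx-dep Bx-indep)

  module _ (Indep? : ∀ A → Dec (Indep M A)) where

    private
      grow-by : ∀ {F J} x → J ⊆ F → Indep M J →
        ∃ λ J' → J ⊆ J' × J' ⊆ F × Indep M J' × (x ∈ F → Spanned J' x)
      grow-by {F} {J} x J⊆F J-indep with x ∈? F | Indep? (J ∪ ⁅ x ⁆)
      ... | yes x∈F | yes Jx-indep = J ∪ ⁅ x ⁆ , x∈p∪q⁺ ∘ inj₁ , Jx⊆F , Jx-indep , λ _ → inj₁ (x∈p∪q⁺ (inj₂ (x∈⁅x⁆ x)))
        where
        Jx⊆F : J ∪ ⁅ x ⁆ ⊆ F
        Jx⊆F y∈ with x∈p∪q⁻ J ⁅ x ⁆ y∈
        ... | inj₁ y∈J = J⊆F y∈J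
        ... | inj₂ y∈⁅x⁆ rewrite x∈⁅y⁆⇒x≡y x y∈⁅x⁆ = x∈F
      ... | yes _   | no Jx-dep = J , (λ y∈ → y∈) , J⊆F , J-indep , λ _ → inj₂ Jx-dep
      ... | no x∉F  | _         = J , (λ y∈ → y∈) , J⊆F , J-indep , λ x∈F → ⊥-elim (x∉F x∈F)

      grow : ∀ {F J} → J ⊆ F → Indep M J → (xs : List (Fin n)) →
        ∃ λ B → J ⊆ B × B ⊆ F × Indep M B × (∀ {x} → x ∈ˡ xs → x ∈ F → Spanned B x)
      grow J⊆F J-indep [] = _ , (λ y∈ → y∈) , J⊆F , J-indep , λ ()
      grow J⊆F J-indep (x ∷ xs) =
        let J' , J⊆J' , J'⊆F , J'-indep , x-spanned = grow-by x J⊆F J-indep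
            B , J'⊆B , B⊆F , B-indep , B-spans = grow J'⊆F J'-indep xs
        in  B , J'⊆B ∘ J⊆J' , B⊆F , B-indep ,
            λ { (here refl) x∈F → Spanned-mono J'⊆B (x-spanned x∈F) ; (there y∈xs) → B-spans y∈xs }

    extend-to-maximal : ∀ {F I} → I ⊆ F → Indep M I → ∃ λ B → I ⊆ B × MaximalIndepIn F B
    extend-to-maximal I⊆F I-indep =
      let B , I⊆B , B⊆F , B-indep , B-spans = grow I⊆F I-indep (allFin n)
      in  B , I⊆B , B⊆F , B-indep , B-spans (∈-allFin _)

    flat-closed : ∀ {F I e} → Flat M F → I ⊆ F → Indep M I → Dependent M (I ∪ ⁅ e ⁆) → e ∈ F
    flat-closed {F} {I} {e} F-flat I⊆F I-indep Ie-dep with e ∈? F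
    ... | yes e∈F = e∈F
    ... | no e∉F with extend-to-maximal I⊆F I-indep
    ...   | B , I⊆B , B⊆F , B-indep , B-spans = ⊥-elim $
      F-flat e e∉F ∣ B ∣ (maximal⇒HasRank (B⊆F , B-indep , B-spans))
                          (maximal⇒HasRank (x∈p∪q⁺ ∘ inj₁ ∘ B⊆F , B-indep , spans))
      where
      spans : ∀ {x} → x ∈ F ∪ ⁅ e ⁆ → Spanned B x
      spans x∈ with x∈p∪q⁻ F ⁅ e ⁆ x∈
      ... | inj₁ x∈F   = B-spans x∈F
      ... | inj₂ x∈⁅e⁆ rewrite x∈⁅y⁆⇒x≡y _ x∈⁅e⁆ = Spanned-mono I⊆B (inj₂ Ie-dep)

  circuit-through : ∀ {F x} → NontrivialConnectedFlat M F → x ∈ F →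
    ∃ λ C → Circuit M C × C ⊆ F × x ∈ C
  circuit-through {F} {x} (_ , F-conn , F-dep) x∈F with any? (λ y → (y ∈? F) ×-dec ¬? (y ≟ᶠ x))
  ... | yes (y , y∈F , y≢x) =
    let C , C-circ , C⊆F , x∈C , _ = F-conn x y x∈F y∈F (y≢x ∘ sym) in C , C-circ , C⊆F , x∈C
  ... | no ∄y = F , (F-dep , proper-indep) , (λ y∈ → y∈) , x∈F
    where
    proper-indep : ∀ D → D ⊂ F → Indep M D
    proper-indep D (D⊆F , y , y∈F , y∉D) = indep-down M D⊆⊥ (indep-empty M)
      where
      ≡x : ∀ {z} → z ∈ F → z ≡ x
      ≡x {z} z∈F with z ≟ᶠ x
      ... | yes z≡x = z≡x
      ... | no z≢x  = ⊥-elim (∄y (z , z∈F , z≢x))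
      D⊆⊥ : D ⊆ ∅
      D⊆⊥ {z} z∈D = ⊥-elim (y∉D (subst (_∈ D) (trans (≡x (D⊆F z∈D)) (sym (≡x y∈F))) z∈D))

-- Lattice path matroids

-- LPIndep asks for a total map Fin (m + r) → Fin r, so for r = 0 not even ∅ is independent in M[P,Q].
IsoToLP⇒NonZero : ∀ {n} {M : Matroid n} {m r P Q} → IsoToLP M m r P Q → Fin n → NonZero r
IsoToLP⇒NonZero {M = M} (φ , iso) e =
  nonZeroIndex (proj₁ (Equivalence.to (iso ∅) ∅-indep) (Inverse.to φ e))
  where
  ∅-indep : Indep M (preimage (Inverse.to φ) ∅)
  ∅-indep = indep-down M (λ x∈ → ⊥-elim (∉⊥ (∈-preimage⁻ (Inverse.to φ) x∈))) (indep-empty M)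

module Presented {n} (M : Matroid n) (m ρ : ℕ) (P Q : Vec Bool (m + ρ))
  (P-path : IsPath m ρ P) (Q-path : IsPath m ρ Q) (P≤Q : NotAbove P Q)
  (iso : IsoToLP M m ρ P Q) {{_ : NonZero ρ}} where

  open LatticePath m ρ P Q P-path Q-path P≤Q

  private
    φ = proj₁ iso
    to = Inverse.to φ
    from = Inverse.from φ

  pos : Fin n → ℕ
  pos = toℕ ∘ to

  pos-injective : ∀ {x y} → pos x ≡ pos y → x ≡ y
  pos-injective {x} {y} ≡ = begin
    x             ≡⟨ Inverse.strictlyInverseʳ φ x ⟨
    from (to x)   ≡⟨ cong from (toℕ-injective ≡) ⟩
    from (to y)   ≡⟨ Inverse.strictlyInverseʳ φ y ⟩
    y             ∎
    where open ≡-Reasoning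

  preimage∘preimage : ∀ A → preimage to (preimage from A) ≡ A
  preimage∘preimage A = trans (tabulate-cong to-from) (tabulate∘lookup A)
    where
    to-from : ∀ x → lookup (preimage from A) (to x) ≡ lookup A x
    to-from x = trans (lookup∘tabulate _ (to x)) (cong (lookup A) (Inverse.strictlyInverseʳ φ x))

  ∣preimage∩window∣ : ∀ S a b → ∣ preimage to S ∩ window pos a b ∣ ≡ ∣ S ∩ window toℕ a b ∣
  ∣preimage∩window∣ S a b = ∣∣-reindex φ (preimage to S ∩ window pos a b) (S ∩ W) λ x → begin
    lookup (preimage to S ∩ window pos a b) x            ≡⟨ lookup-zipWith _∧_ x (preimage to S) _ ⟩
    lookup (preimage to S) x ∧ lookup (window pos a b) x ≡⟨ cong (λ V → _ ∧ lookup V x) (window-preimage to toℕ a b) ⟩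
    lookup (preimage to S) x ∧ lookup (preimage to W) x  ≡⟨ cong₂ _∧_ (lookup∘tabulate _ x) (lookup∘tabulate _ x) ⟩
    lookup S (to x) ∧ lookup W (to x)                    ≡⟨ lookup-zipWith _∧_ (to x) S W ⟨
    lookup (S ∩ W) (to x)                                ∎
    where
    open ≡-Reasoning
    W = window toℕ a b

  Hall-preimage : ∀ S → Hall toℕ S ⇔ Hall pos (preimage to S)
  Hall-preimage S = mk⇔
    (λ hall a b a<b b≤k → subst (λ c → c + yP a ≤ yQ b) (sym (∣preimage∩window∣ S a b)) (hall a b a<b b≤k))
    (λ hall a b a<b b≤k → subst (λ c → c + yP a ≤ yQ b) (∣preimage∩window∣ S a b) (hall a b a<b b≤k))

  indep⇔Hall : ∀ A → Indep M A ⇔ Hall pos A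
  indep⇔Hall A = subst (λ A' → Indep M A' ⇔ Hall pos A') (preimage∘preimage A) (mk⇔
    (Equivalence.to (Hall-preimage S) ∘ LPIndep⇒Hall S ∘ Equivalence.to (proj₂ iso S))
    (Equivalence.from (proj₂ iso S) ∘ Hall⇒LPIndep S ∘ Equivalence.from (Hall-preimage S)))
    where S = preimage from A

  Violation : Subset n → ℕ → ℕ → Set
  Violation A a b = a < b × b ≤ k × yQ b < ∣ A ∩ window pos a b ∣ + yP a

  Hall-or-violation : ∀ A → Hall pos A ⊎ ∃₂ (Violation A)
  Hall-or-violation A with anyUpTo? (λ b → anyUpTo? (λ a → yQ b <? ∣ A ∩ window pos a b ∣ + yP a) b) (suc k)
  ... | yes (b , b<1+k , a , a<b , viol) = inj₂ (a , b , a<b , s≤s⁻¹ b<1+k , viol)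
  ... | no ∄viol = inj₁ λ a b a<b b≤k → ≮⇒≥ λ viol → ∄viol (b , s≤s b≤k , a , a<b , viol)

  Indep? : ∀ A → Dec (Indep M A)
  Indep? A with Hall-or-violation A
  ... | inj₁ hall = yes (Equivalence.from (indep⇔Hall A) hall)
  ... | inj₂ (a , b , a<b , b≤k , viol) =
    no λ A-indep → <⇒≱ viol (Equivalence.to (indep⇔Hall A) A-indep a b a<b b≤k)

  indep-in-window : ∀ {A a b} → Indep M A → A ⊆ window pos a b → a < b → b ≤ k → ∣ A ∣ + yP a ≤ yQ b
  indep-in-window {A} {a} {b} A-indep A⊆w a<b b≤k =
    ≤-trans (+-monoˡ-≤ (yP a) (p⊆q⇒∣p∣≤∣p∩q∣ A⊆w)) (Equivalence.to (indep⇔Hall A) A-indep a b a<b b≤k)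

  violation-covers-circuit : ∀ {C a b} → Circuit M C → Violation C a b → C ⊆ window pos a b
  violation-covers-circuit {C} {a} {b} (_ , C-min) (a<b , b≤k , viol) {z} z∈C with z ∈? window pos a b
  ... | yes z∈w = z∈w
  ... | no z∉w  = ⊥-elim (<⇒≱ viol (≤-trans (+-monoˡ-≤ (yP a) (p⊆q⇒∣p∣≤∣q∣ C∩w⊆C-z∩w)) C-z-hall))
    where
    C-z-hall : ∣ (C - z) ∩ window pos a b ∣ + yP a ≤ yQ b
    C-z-hall = Equivalence.to (indep⇔Hall (C - z)) (C-min (C - z) (x∈p⇒p-x⊂p z∈C)) a b a<b b≤k
    C∩w⊆C-z∩w : C ∩ window pos a b ⊆ (C - z) ∩ window pos a b
    C∩w⊆C-z∩w y∈ with x∈p∩q⁻ C (window pos a b) y∈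
    ... | y∈C , y∈w = x∈p∩q⁺ (x∈p∧x≢y⇒x∈p-y y∈C (λ { refl → z∉w y∈w }) , y∈w)

  record Widening (a b : ℕ) (e : Fin n) : Set where
    constructor widening
    field
      a' b'   : ℕ
      a'≤a    : a' ≤ a
      b≤b'    : b ≤ b'
      b'≤k    : b' ≤ k
      e∈      : e ∈ window pos a' b'
      yP-kept : yP a ≤ yP a'
      yQ-kept : yQ b' ≤ yQ b

  exchange-dependent : ∀ {C c e} → Circuit M C → c ∈ C → e ∉ C →
    (∀ {a b} → b ≤ k → C ⊆ window pos a b → Widening a b e) → Dependent M ((C - c) ∪ ⁅ e ⁆)
  exchange-dependent {C} {c} {e} C-circ c∈C e∉C widen D-indep
    with Hall-or-violation C
  ... | inj₁ hall = proj₁ C-circ (Equivalence.from (indep⇔Hall C) hall)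
  ... | inj₂ (a , b , a<b , b≤k , viol) = <⇒≱ viol (begin
      ∣ C ∩ window pos a b ∣ + yP a    ≤⟨ +-mono-≤ (∣p∩q∣≤∣p∣ C _) yP-kept ⟩
      ∣ C ∣ + yP a'                    ≤⟨ +-monoˡ-≤ (yP a') (∣p∣≤∣p-x∪⁅y⁆∣ C e∉C) ⟩
      ∣ D ∣ + yP a'                    ≤⟨ indep-in-window D-indep D⊆w' (≤-trans (s≤s a'≤a) (≤-trans a<b b≤b')) b'≤k ⟩
      yQ b'                            ≤⟨ yQ-kept ⟩
      yQ b                             ∎)
    where
    open ≤-Reasoning
    D = (C - c) ∪ ⁅ e ⁆
    C⊆w = violation-covers-circuit C-circ (a<b , b≤k , viol)
    open Widening (widen b≤k C⊆w)
    D⊆w' : D ⊆ window pos a' b'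
    D⊆w' x∈D with x∈p∪q⁻ (C - c) ⁅ e ⁆ x∈D
    ... | inj₁ x∈C-c = window-mono a'≤a b≤b' (C⊆w (p─q⊆p C _ x∈C-c))
    ... | inj₂ x∈⁅e⁆ rewrite x∈⁅y⁆⇒x≡y _ x∈⁅e⁆ = e∈

  absorbs : ∀ {F C c e} → Flat M F → Circuit M C → C ⊆ F → c ∈ C →
    (∀ {a b} → b ≤ k → C ⊆ window pos a b → Widening a b e) → e ∈ F
  absorbs {F} {C} {c} {e} F-flat C-circ C⊆F c∈C widen with e ∈? C
  ... | yes e∈C = C⊆F e∈C
  ... | no e∉C  = flat-closed M Indep? F-flat (C⊆F ∘ p─q⊆p C _) (proj₂ C-circ (C - c) (x∈p⇒p-x⊂p c∈C))
                    (exchange-dependent C-circ c∈C e∉C widen)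

  absorbs-between : ∀ {F u v e} → NontrivialConnectedFlat M F → u ∈ F → v ∈ F →
    pos u < pos e → pos e < pos v → e ∈ F
  absorbs-between {u = u} {v} (F-flat , F-conn , _) u∈F v∈F u<e e<v
    with F-conn u v u∈F v∈F (λ { refl → <-asym u<e e<v })
  ... | C , C-circ , C⊆F , u∈C , v∈C = absorbs F-flat C-circ C⊆F u∈C λ {a} {b} b≤k C⊆w →
    widening a b ≤-refl ≤-refl b≤k
      (∈-window⁺ (≤-trans (proj₁ (∈-window⁻ (C⊆w u∈C))) (<⇒≤ u<e))
                 (<-trans e<v (proj₂ (∈-window⁻ (C⊆w v∈C)))))
      ≤-refl ≤-refl

  absorbs-after : ∀ {F y e} → NontrivialConnectedFlat M F → y ∈ F → pos y < pos e →
    ρ ≤ yQ (suc (pos y)) → e ∈ F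
  absorbs-after {y = y} {e} F-ncf y∈F y<e ρ≤yQ[1+y] with circuit-through M F-ncf y∈F
  ... | C , C-circ , C⊆F , y∈C = absorbs (proj₁ F-ncf) C-circ C⊆F y∈C λ {a} {b} b≤k C⊆w →
    let a≤y , y<b = ∈-window⁻ (C⊆w y∈C) in
    widening a (b ⊔ suc (pos e)) ≤-refl (m≤m⊔n b _) (⊔-lub b≤k (toℕ<n (to e)))
      (∈-window⁺ (≤-trans a≤y (<⇒≤ y<e)) (m≤n⊔m b _)) ≤-refl
      (≤-trans (yQ≤ρ (⊔-lub b≤k (toℕ<n (to e)))) (≤-trans ρ≤yQ[1+y] (yQ-mono y<b)))

  absorbs-before : ∀ {F y e} → NontrivialConnectedFlat M F → y ∈ F → pos e < pos y →
    yP (pos y) ≡ 0 → e ∈ F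
  absorbs-before {y = y} {e} F-ncf y∈F e<y yP[y]≡0 with circuit-through M F-ncf y∈F
  ... | C , C-circ , C⊆F , y∈C = absorbs (proj₁ F-ncf) C-circ C⊆F y∈C λ {a} {b} b≤k C⊆w →
    let a≤y , y<b = ∈-window⁻ (C⊆w y∈C) in
    widening (a ⊓ pos e) b (m⊓n≤m a _) ≤-refl b≤k (∈-window⁺ (m⊓n≤n a _) (<-trans e<y y<b))
      (≤-trans (yP-mono a≤y) (≤-trans (≤-reflexive yP[y]≡0) z≤n)) ≤-refl

  ρ≤rank : ∀ {r} → RankOf M r → ρ ≤ r
  ρ≤rank (_ , maximum) = begin
    ρ                       ≡⟨ Q-path ⟨
    prefixN Q k             ≡⟨ ∣v∣≡prefixN Q ⟨
    ∣ Q ∣                   ≡⟨ ∣∣-reindex φ (preimage to Q) Q (λ x → lookup∘tabulate _ x) ⟨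
    ∣ preimage to Q ∣       ≤⟨ maximum _ (λ _ → ∈⊤) (Equivalence.from (proj₂ iso Q) (Hall⇒LPIndep Q Hall-Q)) ⟩
    _                       ∎
    where open ≤-Reasoning

  module _ {r X X'} (M-rank : RankOf M r) (X-ncf : NontrivialConnectedFlat M X)
    (X'-ncf : NontrivialConnectedFlat M X') {w} (w∈X∩X' : w ∈ X ∩ X')
    {B} (B⊆Y : B ⊆ X ∪ X') (B-indep : Indep M B) (∣B∣≡r : ∣ B ∣ ≡ r) where

    private
      Y : Subset n
      Y = X ∪ X'

      w∈X : w ∈ X
      w∈X = proj₁ (x∈p∩q⁻ X X' w∈X∩X')

      w∈X' : w ∈ X'
      w∈X' = proj₂ (x∈p∩q⁻ X X' w∈X∩X')

      w∈Y : w ∈ Y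
      w∈Y = x∈p∪q⁺ (inj₁ w∈X)

      top bottom : Fin n
      top = proj₁ (heaviest pos Y (w , w∈Y))
      bottom = proj₁ (lightest pos Y (w , w∈Y))

      top∈Y : top ∈ Y
      top∈Y = proj₁ (proj₂ (heaviest pos Y (w , w∈Y)))

      bottom∈Y : bottom ∈ Y
      bottom∈Y = proj₁ (proj₂ (lightest pos Y (w , w∈Y)))

      ≤top : ∀ {x} → x ∈ Y → pos x ≤ pos top
      ≤top = proj₂ (proj₂ (heaviest pos Y (w , w∈Y)))

      bottom≤ : ∀ {x} → x ∈ Y → pos bottom ≤ pos x
      bottom≤ = proj₂ (proj₂ (lightest pos Y (w , w∈Y)))

      absorbed-via : ∀ {y e} → y ∈ Y → (∀ {F} → NontrivialConnectedFlat M F → w ∈ F → y ∈ F → e ∈ F) → e ∈ Y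
      absorbed-via y∈Y absorb with x∈p∪q⁻ X X' y∈Y
      ... | inj₁ y∈X  = x∈p∪q⁺ (inj₁ (absorb X-ncf w∈X y∈X))
      ... | inj₂ y∈X' = x∈p∪q⁺ (inj₂ (absorb X'-ncf w∈X' y∈X'))

    ρ≤yQ[1+top] : ρ ≤ yQ (suc (pos top))
    ρ≤yQ[1+top] = begin
      ρ                    ≤⟨ ρ≤rank M-rank ⟩
      r                    ≡⟨ ∣B∣≡r ⟨
      ∣ B ∣                ≤⟨ m≤m+n ∣ B ∣ _ ⟩
      ∣ B ∣ + yP 0         ≤⟨ indep-in-window B-indep B⊆w (s≤s z≤n) (toℕ<n (to top)) ⟩
      yQ (suc (pos top))   ∎
      where
      open ≤-Reasoning
      B⊆w : B ⊆ window pos 0 (suc (pos top))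
      B⊆w x∈B = ∈-window⁺ z≤n (s≤s (≤top (B⊆Y x∈B)))

    yP[bottom]≡0 : yP (pos bottom) ≡ 0
    yP[bottom]≡0 = n≤0⇒n≡0 (+-cancelˡ-≤ ∣ B ∣ _ _ (begin
      ∣ B ∣ + yP (pos bottom)   ≤⟨ indep-in-window B-indep B⊆w (toℕ<n (to bottom)) ≤-refl ⟩
      yQ k                      ≡⟨ Q-path ⟩
      ρ                         ≤⟨ ρ≤rank M-rank ⟩
      r                         ≡⟨ ∣B∣≡r ⟨
      ∣ B ∣                     ≡⟨ +-identityʳ ∣ B ∣ ⟨
      ∣ B ∣ + 0                 ∎))
      where
      open ≤-Reasoning
      B⊆w : B ⊆ window pos (pos bottom) k
      B⊆w {x} x∈B = ∈-window⁺ (bottom≤ (B⊆Y x∈B)) (toℕ<n (to x))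

    spanning-flats-cover : ∀ e → e ∈ X ∪ X'
    spanning-flats-cover e with <-cmp (pos w) (pos e)
    ... | tri≈ _ w≡e _ = subst (_∈ Y) (pos-injective w≡e) w∈Y
    ... | tri< w<e _ _ with <-cmp (pos e) (pos top)
    ...   | tri< e<top _ _ =
      absorbed-via top∈Y λ F-ncf w∈F top∈F → absorbs-between F-ncf w∈F top∈F w<e e<top
    ...   | tri≈ _ e≡top _ = subst (_∈ Y) (pos-injective (sym e≡top)) top∈Y
    ...   | tri> _ _ top<e =
      absorbed-via top∈Y λ F-ncf _ top∈F → absorbs-after F-ncf top∈F top<e ρ≤yQ[1+top]
    spanning-flats-cover e | tri> _ _ e<w with <-cmp (pos bottom) (pos e)
    ...   | tri< bottom<e _ _ =
      absorbed-via bottom∈Y λ F-ncf w∈F bottom∈F → absorbs-between F-ncf bottom∈F w∈F bottom<e e<w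
    ...   | tri≈ _ bottom≡e _ = subst (_∈ Y) (pos-injective bottom≡e) bottom∈Y
    ...   | tri> _ _ e<bottom =
      absorbed-via bottom∈Y λ F-ncf _ bottom∈F → absorbs-before F-ncf bottom∈F e<bottom yP[bottom]≡0

theorem3p14 : ∀ {n : ℕ} (M : Matroid n) (r : ℕ) (X X' : Subset n) →
    RankOf M r →
    NontrivialConnectedFlat M X →
    NontrivialConnectedFlat M X' →
    Nonempty (X ∩ X') →
    HasRank M (X ∪ X') r →
    (X ∪ X') ⊂ ⊤ →
    ¬ IsLatticePathMatroid M
theorem3p14 M r X X' M-rank X-ncf X'-ncf (w , w∈X∩X') ((B , B⊆Y , B-indep , ∣B∣≡r) , _) (_ , e , _ , e∉Y)
  (m , ρ , P , Q , P-path , Q-path , P≤Q , iso) =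
  e∉Y (spanning-flats-cover M-rank X-ncf X'-ncf w∈X∩X' B⊆Y B-indep ∣B∣≡r e)
  where
  instance
    ρ≢0 : NonZero ρ
    ρ≢0 = IsoToLP⇒NonZero {M = M} {P = P} {Q = Q} iso e
  open Presented M m ρ P Q P-path Q-path P≤Q iso
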